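{- The $\mathbb{F}$-dimension of $\mathbb{T}$ equals $2^{n_1+2n_4}3^{n_4}5^{n_1}11^{n_2+n_3}$.
   Context: Let $\mathbb{F}$ be a field. Fix $n\ge1$ and integers $\ell_1,\dots,\ell_n,m_1,\dots,m_n\ge2$. For each $i\in\{1,\dots,n\}$ let $U_i$ be a set with $|U_i|=\ell_im_i$ partitioned into $\ell_i$ blocks of size $m_i$, with relations $R^i_0=\{(a,a)\}$, $R^i_1=\{(a,b):a\ne b\text{ in the same block}\}$, $R^i_2=\{(a,b):a,b\text{ in different blocks}\}$ (group divisible scheme). Let $X=\prod_iU_i$, $E$ the set of $n$-tuples with entries in $\{0,1,2\}$, and $R_{\mathbf{g}}=\{(\mathbf{a},\mathbf{b})\in X\times X:(\mathbf{a}_i,\mathbf{b}_i)\in R^i_{\mathbf{g}_i}\ \forall i\}$ for $\mathbf{g}\in E$ (direct product scheme). Let $n_1,n_2,n_3,n_4$ be the numbers of $a\in\{1,\dots,n\}$ with, respectively, $\ell_a=m_a=2$; $\ell_a>m_a=2$; $m_a>\ell_a=2$; $\min\{\ell_a,m_a\}>2$. Fix $\mathbf{x}\in X$. For $\mathbf{g}\in E$ let $A_{\mathbf{g}}\in\mathrm{M}_X(\mathbb{F})$ be the $0/1$ adjacency matrix of $R_{\mathbf{g}}$ and $E^*_{\mathbf{g}}$ the diagonal matrix with $(\mathbf{y},\mathbf{y})$-entry $1$ iff $(\mathbf{x},\mathbf{y})\in R_{\mathbf{g}}$. $\mathbb{T}$ is the $\mathbb{F}$-subalgebra of $\mathrm{M}_X(\mathbb{F})$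 generated by all $A_{\mathbf{g}},E^*_{\mathbf{g}}$. -}

module Defs where

open import Level using (Level; _⊔_) renaming (suc to lsuc)
open import Algebra.Bundles using (CommutativeRing)
open import Data.Nat using (ℕ; zero; suc; _≡ᵇ_; _<ᵇ_)
import Data.Nat as N
open import Data.Fin using (Fin; zero; suc) renaming (_≟_ to _≟F_)
open import Data.Bool using (Bool; true; false; if_then_else_; _∧_)
open import Data.Product using (_×_; _,_; ∃)
open import Relation.Nullary using (¬_; does)

record Field (c ℓ : Level) : Set (lsuc (c ⊔ ℓ)) where
  field
    commutativeRing : CommutativeRing c ℓ
  open CommutativeRing commutativeRing public
  field
    1≉0     : ¬ (1# ≈ 0#)
    inverse : ∀ x → ¬ (x ≈ 0#) → ∃ λ y → (x * y) ≈ 1#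

allB : (k : ℕ) → (Fin k → Bool) → Bool
allB zero    P = true
allB (suc k) P = P zero ∧ allB k (λ i → P (suc i))

count : (k : ℕ) → (Fin k → Bool) → ℕ
count zero    P = 0
count (suc k) P = (if P zero then 1 else 0) N.+ count k (λ i → P (suc i))

-- relation indices {0,1,2}
-- U = Fin l × Fin m : (block, position in block); |U| = l m, l blocks of size m
-- classU a b = 0 if a = b, 1 if a ≠ b in the same block, 2 if in different blocks
classU : ∀ {l m} → Fin l × Fin m → Fin l × Fin m → Fin 3
classU (b , p) (b' , p') with does (b ≟F b') | does (p ≟F p')
... | true  | true  = zero
... | true  | false = suc zero
... | false | _     = suc (suc zero)

_≡F3_ : Fin 3 → Fin 3 → Bool
i ≡F3 j = does (i ≟F j)

Pt : (n : ℕ) → (Fin n → ℕ) → (Fin n → ℕ) → Set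
Pt n ℓ m = (i : Fin n) → Fin (ℓ i) × Fin (m i)

Idx : ℕ → Set
Idx n = Fin n → Fin 3

inR : ∀ n ℓ m → Idx n → Pt n ℓ m → Pt n ℓ m → Bool
inR n ℓ m g a b = allB n (λ i → classU (a i) (b i) ≡F3 g i)

eqPt : ∀ n ℓ m → Pt n ℓ m → Pt n ℓ m → Bool
eqPt n ℓ m = inR n ℓ m (λ _ → zero)

module _ {c ℓF : Level} (F : Field c ℓF) where
  open Field F using (Carrier; _≈_; _+_; _*_; 0#; 1#)

  sumFin : (k : ℕ) → (Fin k → Carrier) → Carrier
  sumFin zero    f = 0#
  sumFin (suc k) f = f zero + sumFin k (λ i → f (suc i))

  sumU : (l m : ℕ) → (Fin l × Fin m → Carrier) → Carrier
  sumU l m f = sumFin l (λ b → sumFin m (λ p → f (b , p)))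

  consPt : ∀ {n} {ℓ m : Fin (suc n) → ℕ} →
           Fin (ℓ zero) × Fin (m zero) →
           Pt n (λ i → ℓ (suc i)) (λ i → m (suc i)) → Pt (suc n) ℓ m
  consPt a t zero    = a
  consPt a t (suc i) = t i

  sumX : ∀ n ℓ m → (Pt n ℓ m → Carrier) → Carrier
  sumX zero    ℓ m f = f (λ ())
  sumX (suc n) ℓ m f =
    sumU (ℓ zero) (m zero) (λ a →
      sumX n (λ i → ℓ (suc i)) (λ i → m (suc i)) (λ t → f (consPt a t)))

  module Matrices (n : ℕ) (ℓ m : Fin n → ℕ) where

    Mat : Set c
    Mat = Pt n ℓ m → Pt n ℓ m → Carrier

    _≈M_ : Mat → Mat → Set ℓF
    M ≈M N = ∀ a b → M a b ≈ N a b

    _+M_ : Mat → Mat → Mat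
    (M +M N) a b = M a b + N a b

    _·M_ : Carrier → Mat → Mat
    (k ·M M) a b = k * M a b

    _*M_ : Mat → Mat → Mat
    (M *M N) a b = sumX n ℓ m (λ z → M a z * N z b)

    0M : Mat
    0M a b = 0#

    ind : Bool → Carrier
    ind true  = 1#
    ind false = 0#

    A : Idx n → Mat
    A g a b = ind (inR n ℓ m g a b)

    E* : Pt n ℓ m → Idx n → Mat
    E* x g a b = ind (eqPt n ℓ m a b ∧ inR n ℓ m g x a)

    -- the Terwilliger algebra T(x): the F-subalgebra of M_X(F) generated by
    -- all A_g and E*_g (membership predicate, closed under the matrix
    -- equality, sums, scalar multiples and products)
    data InT (x : Pt n ℓ m) : Mat → Set (c ⊔ ℓF) where
      genA  : ∀ g → InT x (A g)
      genE  : ∀ g → InT x (E* x g)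
      zeroT : InT x 0M
      addT  : ∀ {M N} → InT x M → InT x N → InT x (M +M N)
      scalT : ∀ k {M} → InT x M → InT x (k ·M M)
      mulT  : ∀ {M N} → InT x M → InT x N → InT x (M *M N)
      respT : ∀ {M N} → M ≈M N → InT x M → InT x N

    lincomb : (d : ℕ) → (Fin d → Carrier) → (Fin d → Mat) → Mat
    lincomb d k B a b = sumFin d (λ i → k i * B i a b)

    HasDim : ∀ {p} → (Mat → Set p) → ℕ → Set (c ⊔ ℓF ⊔ p)
    HasDim S d = ∃ λ (B : Fin d → Mat) →
        (∀ i → S (B i))
      × (∀ k → lincomb d k B ≈M 0M → ∀ i → k i ≈ 0#)
      × (∀ M → S M → ∃ λ k → M ≈M lincomb d k B)

module _ (n : ℕ) (ℓ m : Fin n → ℕ) where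
  n₁ n₂ n₃ n₄ : ℕ
  n₁ = count n (λ i → (ℓ i ≡ᵇ 2) ∧ (m i ≡ᵇ 2))
  n₂ = count n (λ i → (m i ≡ᵇ 2) ∧ (2 <ᵇ ℓ i))
  n₃ = count n (λ i → (ℓ i ≡ᵇ 2) ∧ (2 <ᵇ m i))
  n₄ = count n (λ i → (2 <ᵇ ℓ i) ∧ (2 <ᵇ m i))

dimFormula : (n : ℕ) → (ℓ m : Fin n → ℕ) → ℕ
dimFormula n ℓ m =
  2 N.^ (n₁ n ℓ m N.+ 2 N.* n₄ n ℓ m) N.* 3 N.^ n₄ n ℓ m N.* 5 N.^ n₁ n ℓ m
    N.* 11 N.^ (n₂ n ℓ m N.+ n₃ n ℓ m)

-- Fix the base point x.  The automorphisms of each group divisible scheme U_i (permute the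
-- blocks, and the points inside each block) that fix x_i act on X, and the generators A_g,
-- E*_g of T are invariant under them; invariance survives products by reindexing the sum.
-- Conversely, two pairs (u, w) and (u', w') lie in one orbit of this stabiliser as soon as,
-- in every coordinate, the triangles (x_i, u_i, w_i) and (x_i, u'_i, w'_i) have the same
-- triple of classes.  The indicator of such a set of pairs is E*_a A_b E*_c ∈ T, so these
-- indicators form a basis of T.  Their number is the product over i of the number of
-- triangle types occurring in U_i: 10, 11, 11 or 12 in the four cases counted by n₁, …, n₄.

module Submission where

open import Defs
open import Level using (Level)
open import Data.Nat using (ℕ; _≤_)
open import Data.Fin using (Fin)

open import Data.Bool using (Bool; true; false; if_then_else_; _∧_; T)
open import Data.Bool.Properties using (T-∧)
open import Data.Fin using (zero; suc; combine; remQuot)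
open import Data.Nat as Nat using (zero; suc; z≤n; s≤s; _<ᵇ_)
open import Data.Fin.Patterns using (0F; 1F; 2F)
open import Data.Fin.Properties using (_≟_; remQuot-combine; combine-remQuot)
open import Data.Fin.Permutation as Perm using (Permutation′; _⟨$⟩ʳ_; _∘ₚ_)
import Data.Fin.Permutation.Components as PC
open import Data.List using (List; []; _∷_; [_]; _++_; length; lookup)
open import Data.List.Membership.Propositional using (_∈_)
open import Data.List.Membership.Propositional.Properties using (∈-++⁺ˡ; ∈-++⁺ʳ; ∈-lookup)
open import Data.List.Relation.Unary.All as All using (All; []; _∷_)
open import Data.List.Relation.Unary.All.Properties using (++⁺)
open import Data.List.Relation.Unary.AllPairs using (_∷_)
open import Data.List.Relation.Unary.Any using (here; index)
open import Data.List.Relation.Unary.Any.Properties using (lookup-index)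
open import Data.List.Relation.Unary.Unique.Propositional using (Unique)
open import Data.Product using (_×_; _,_; proj₁; proj₂; Σ; ∃₂)
open import Data.Product.Properties using (≡-dec)
open import Function using (_∘_; _⇔_; mk⇔)
open import Function.Properties.Inverse using (↔⇒↣)
open import Function.Bundles using (Injection; Equivalence)
open Equivalence using (to; from)
open import Relation.Binary.PropositionalEquality
  using (_≡_; _≢_; refl; sym; trans; cong; cong₂; subst; module ≡-Reasoning)
open import Relation.Nullary using (Dec; yes; no; does; contradiction)
open import Relation.Nullary.Decidable using (True; toWitness; from-yes; dec-true; does-⇔; T?)

import Data.List.Membership.DecPropositional as DecMembership
import Data.List.Relation.Unary.Unique.DecPropositional as DecUnique

private
  variable
    l m : ℕ

-- Classes and triangle types in one group divisible scheme

U : ℕ → ℕ → Set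
U l m = Fin l × Fin m

data ClassView {l m} : U l m → U l m → Fin 3 → Set where
  equal      : ∀ {b p} → ClassView (b , p) (b , p) 0F
  sameBlock  : ∀ {b p q} → p ≢ q → ClassView (b , p) (b , q) 1F
  otherBlock : ∀ {b c p q} → b ≢ c → ClassView (b , p) (c , q) 2F

classView : (a a' : U l m) → ClassView a a' (classU a a')
classView (b , p) (c , q) with b ≟ c | p ≟ q
... | yes refl | yes refl = equal
... | yes refl | no p≢q   = sameBlock p≢q
... | no b≢c   | _        = otherBlock b≢c

classView-unique : ∀ {a a' : U l m} {k k'} → ClassView a a' k → ClassView a a' k' → k ≡ k'
classView-unique equal            equal            = refl
classView-unique equal            (sameBlock p≢p)  = contradiction refl p≢p
classView-unique equal            (otherBlock b≢b) = contradiction refl b≢b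
classView-unique (sameBlock p≢p)  equal            = contradiction refl p≢p
classView-unique (sameBlock _)    (sameBlock _)    = refl
classView-unique (sameBlock _)    (otherBlock b≢b) = contradiction refl b≢b
classView-unique (otherBlock b≢b) equal            = contradiction refl b≢b
classView-unique (otherBlock b≢b) (sameBlock _)    = contradiction refl b≢b
classView-unique (otherBlock _)   (otherBlock _)   = refl

classU-view : ∀ {a a' : U l m} {k} → ClassView a a' k → classU a a' ≡ k
classU-view {a = a} {a'} = classView-unique (classView a a')

viewOf : ∀ {a a' : U l m} {k} → classU a a' ≡ k → ClassView a a' k
viewOf {a = a} {a'} e = subst (ClassView a a') e (classView a a')

classU-sym : (a a' : U l m) → classU a a' ≡ classU a' a
classU-sym a a' = classU-view (flipView (classView a' a))
  where
  flipView : ∀ {a a' : U l m} {k} → ClassView a a' k → ClassView a' a k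
  flipView equal            = equal
  flipView (sameBlock p≢q)  = sameBlock (p≢q ∘ sym)
  flipView (otherBlock b≢c) = otherBlock (b≢c ∘ sym)

classU≡0-split : (b c : Fin l) (p q : Fin m) → (classU (b , p) (c , q) ≡F3 0F) ≡ does (b ≟ c) ∧ does (p ≟ q)
classU≡0-split b c p q with b ≟ c | p ≟ q
... | yes _ | yes _ = refl
... | yes _ | no _  = refl
... | no _  | _     = refl

module _ {z y y' : U l m} (e : classU z y ≡ classU z y') where

  sameBlock-transfer : proj₁ z ≡ proj₁ y → proj₁ z ≡ proj₁ y'
  sameBlock-transfer = go (classView z y) (viewOf (sym e))
    where
    go : ∀ {k} → ClassView z y k → ClassView z y' k → proj₁ z ≡ proj₁ y → proj₁ z ≡ proj₁ y'
    go _                 equal          _   = refl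
    go _                 (sameBlock _)  _   = refl
    go (otherBlock b≢c)  (otherBlock _) b≡c = contradiction b≡c b≢c

  equal-transfer : z ≡ y → z ≡ y'
  equal-transfer = go (classView z y) (viewOf (sym e))
    where
    go : ∀ {k} → ClassView z y k → ClassView z y' k → z ≡ y → z ≡ y'
    go _                equal          _    = refl
    go (sameBlock p≢q)  (sameBlock _)  z≡y  = contradiction (cong proj₂ z≡y) p≢q
    go (otherBlock b≢c) (otherBlock _) z≡y  = contradiction (cong proj₁ z≡y) b≢c

TriangleType : Set
TriangleType = Fin 3 × Fin 3 × Fin 3

triangleType : U l m → U l m → U l m → TriangleType
triangleType x u w = classU x u , classU u w , classU x w

_≟ᵀ_ : (t t' : TriangleType) → Dec (t ≡ t')
_≟ᵀ_ = ≡-dec _≟_ (≡-dec _≟_ _≟_)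

open DecMembership _≟ᵀ_ using (_∈?_)
open DecUnique _≟ᵀ_ using (unique?)

commonTypes : List TriangleType
commonTypes =
  (0F , 0F , 0F) ∷ (0F , 1F , 1F) ∷ (0F , 2F , 2F) ∷ (1F , 0F , 1F) ∷ (1F , 1F , 0F) ∷
  (1F , 2F , 2F) ∷ (2F , 0F , 2F) ∷ (2F , 1F , 2F) ∷ (2F , 2F , 0F) ∷ (2F , 2F , 1F) ∷ []

triangleTypesWith : Bool → Bool → List TriangleType
triangleTypesWith threePoints threeBlocks =
  commonTypes ++ (if threePoints then [ (1F , 1F , 1F) ] else [])
              ++ (if threeBlocks then [ (2F , 2F , 2F) ] else [])

-- An equilateral triangle of class 1 needs three points in a block, one of class 2 three blocks.
triangleTypes : ℕ → ℕ → List TriangleType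
triangleTypes l m = triangleTypesWith (2 <ᵇ m) (2 <ᵇ l)

triangleTypesWith-unique : ∀ p b → Unique (triangleTypesWith p b)
triangleTypesWith-unique false false = from-yes (unique? (triangleTypesWith false false))
triangleTypesWith-unique false true  = from-yes (unique? (triangleTypesWith false true))
triangleTypesWith-unique true  false = from-yes (unique? (triangleTypesWith true false))
triangleTypesWith-unique true  true  = from-yes (unique? (triangleTypesWith true true))

triangleTypes-unique : ∀ l m → Unique (triangleTypes l m)
triangleTypes-unique l m = triangleTypesWith-unique (2 <ᵇ m) (2 <ᵇ l)

three-distinct : ∀ {k} {p q r : Fin k} → p ≢ q → q ≢ r → p ≢ r → 3 ≤ k
three-distinct {suc (suc (suc _))} _ _ _ = s≤s (s≤s (s≤s z≤n))
three-distinct {suc (suc zero)} {0F} {0F} p≢q _ _ = contradiction refl p≢q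
three-distinct {suc (suc zero)} {1F} {1F} p≢q _ _ = contradiction refl p≢q
three-distinct {suc (suc zero)} {0F} {1F} {0F} _ _ p≢r = contradiction refl p≢r
three-distinct {suc (suc zero)} {0F} {1F} {1F} _ q≢r _ = contradiction refl q≢r
three-distinct {suc (suc zero)} {1F} {0F} {0F} _ q≢r _ = contradiction refl q≢r
three-distinct {suc (suc zero)} {1F} {0F} {1F} _ _ p≢r = contradiction refl p≢r
three-distinct {suc zero} {0F} {0F} p≢q _ _ = contradiction refl p≢q

common∈ : ∀ {t ts} {t∈ : True (t ∈? commonTypes)} → t ∈ commonTypes ++ ts
common∈ {t∈ = t∈} = ∈-++⁺ˡ (toWitness t∈)

equilateral₁∈ : 3 ≤ m → (1F , 1F , 1F) ∈ triangleTypes l m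
equilateral₁∈ (s≤s (s≤s (s≤s _))) = ∈-++⁺ʳ commonTypes (here refl)

equilateral₂∈ : 3 ≤ l → (2F , 2F , 2F) ∈ triangleTypes l m
equilateral₂∈ {m = m} (s≤s (s≤s (s≤s _))) =
  ∈-++⁺ʳ commonTypes (∈-++⁺ʳ (if 2 <ᵇ m then _ else []) (here refl))

triangle∈ : ∀ {x u w : U l m} {k₁ k₂ k₃} →
            ClassView x u k₁ → ClassView u w k₂ → ClassView x w k₃ → (k₁ , k₂ , k₃) ∈ triangleTypes l m
triangle∈ equal          equal          equal          = common∈
triangle∈ equal          equal          (sameBlock n)  = contradiction refl n
triangle∈ equal          equal          (otherBlock n) = contradiction refl n
triangle∈ equal          (sameBlock n)  equal          = contradiction refl n
triangle∈ equal          (sameBlock _)  (sameBlock _)  = common∈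
triangle∈ equal          (sameBlock _)  (otherBlock n) = contradiction refl n
triangle∈ equal          (otherBlock n) equal          = contradiction refl n
triangle∈ equal          (otherBlock n) (sameBlock _)  = contradiction refl n
triangle∈ equal          (otherBlock _) (otherBlock _) = common∈
triangle∈ (sameBlock n)  equal          equal          = contradiction refl n
triangle∈ (sameBlock _)  equal          (sameBlock _)  = common∈
triangle∈ (sameBlock _)  equal          (otherBlock n) = contradiction refl n
triangle∈ (sameBlock _)  (sameBlock _)  equal          = common∈
triangle∈ {l = l} (sameBlock n₁) (sameBlock n₂) (sameBlock n₃) =
  equilateral₁∈ {l = l} (three-distinct n₁ n₂ n₃)
triangle∈ (sameBlock _)  (sameBlock _)  (otherBlock n) = contradiction refl n
triangle∈ (sameBlock _)  (otherBlock n) equal          = contradiction refl n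
triangle∈ (sameBlock _)  (otherBlock n) (sameBlock _)  = contradiction refl n
triangle∈ (sameBlock _)  (otherBlock _) (otherBlock _) = common∈
triangle∈ (otherBlock n) equal          equal          = contradiction refl n
triangle∈ (otherBlock n) equal          (sameBlock _)  = contradiction refl n
triangle∈ (otherBlock _) equal          (otherBlock _) = common∈
triangle∈ (otherBlock n) (sameBlock _)  equal          = contradiction refl n
triangle∈ (otherBlock n) (sameBlock _)  (sameBlock _)  = contradiction refl n
triangle∈ (otherBlock _) (sameBlock _)  (otherBlock _) = common∈
triangle∈ (otherBlock _) (otherBlock _) equal          = common∈
triangle∈ (otherBlock _) (otherBlock _) (sameBlock _)  = common∈
triangle∈ {m = m} (otherBlock n₁) (otherBlock n₂) (otherBlock n₃) =
  equilateral₂∈ {m = m} (three-distinct n₁ n₂ n₃)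

triangleType∈ : (x u w : U l m) → triangleType x u w ∈ triangleTypes l m
triangleType∈ x u w = triangle∈ (classView x u) (classView u w) (classView x w)

-- Automorphisms: the wreath product Sym m ≀ Sym l

record Aut (l m : ℕ) : Set where
  field
    onBlocks : Permutation′ l
    inBlock  : Fin l → Permutation′ m

  apply : U l m → U l m
  apply a = onBlocks ⟨$⟩ʳ proj₁ a , inBlock (proj₁ a) ⟨$⟩ʳ proj₂ a

open Aut using (onBlocks; inBlock; apply)

idAut : Aut l m
idAut = record { onBlocks = Perm.id ; inBlock = λ _ → Perm.id }

_∘ᴬ_ : Aut l m → Aut l m → Aut l m
α ∘ᴬ β = record
  { onBlocks = onBlocks β ∘ₚ onBlocks α
  ; inBlock  = λ b → inBlock β b ∘ₚ inBlock α (onBlocks β ⟨$⟩ʳ b) }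

perm-injective : ∀ {k} (π : Permutation′ k) {i j} → π ⟨$⟩ʳ i ≡ π ⟨$⟩ʳ j → i ≡ j
perm-injective π = Injection.injective (↔⇒↣ π)

classU-apply : (α : Aut l m) (a a' : U l m) → classU (apply α a) (apply α a') ≡ classU a a'
classU-apply α a a' = classU-view (go (classView a a'))
  where
  go : ∀ {a a' k} → ClassView a a' k → ClassView (apply α a) (apply α a') k
  go equal            = equal
  go (sameBlock p≢q)  = sameBlock (p≢q ∘ perm-injective (inBlock α _))
  go (otherBlock b≢c) = otherBlock (b≢c ∘ perm-injective (onBlocks α))

triangleType-apply : (α : Aut l m) (x u w : U l m) →
                     triangleType (apply α x) (apply α u) (apply α w) ≡ triangleType x u w
triangleType-apply α x u w =
  cong₂ _,_ (classU-apply α x u) (cong₂ _,_ (classU-apply α u w) (classU-apply α x w))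

transpose-maps : ∀ {k} (i j : Fin k) → PC.transpose i j i ≡ j
transpose-maps i j rewrite dec-true (i ≟ i) refl = refl

transpose-fixes : ∀ {k} {i j c : Fin k} → (c ≡ i → i ≡ j) → (c ≡ j → i ≡ j) → PC.transpose i j c ≡ c
transpose-fixes {i = i} {j} {c} h₁ h₂ with c ≟ i
... | yes refl = sym (h₁ refl)
... | no _ with c ≟ j
...   | yes refl = h₂ refl
...   | no _     = refl

onlyInBlock : ∀ {k} → Fin l → Permutation′ k → Fin l → Permutation′ k
onlyInBlock b π c = if does (c ≟ b) then π else Perm.id

onlyInBlock-here : ∀ {k} (b : Fin l) (π : Permutation′ k) q → onlyInBlock b π b ⟨$⟩ʳ q ≡ π ⟨$⟩ʳ q
onlyInBlock-here b π q rewrite dec-true (b ≟ b) refl = refl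

onlyInBlock-fixes : ∀ {k} {b c : Fin l} {π : Permutation′ k} {q} →
                    (c ≡ b → π ⟨$⟩ʳ q ≡ q) → onlyInBlock b π c ⟨$⟩ʳ q ≡ q
onlyInBlock-fixes {b = b} {c} h with c ≟ b
... | yes c≡b = h c≡b
... | no _    = refl

moveTo : U l m → U l m → Aut l m
moveTo (b , p) (b' , p') = record
  { onBlocks = Perm.transpose b b'
  ; inBlock  = onlyInBlock b (Perm.transpose p p') }

moveTo-maps : (y y' : U l m) → apply (moveTo y y') y ≡ y'
moveTo-maps (b , p) (b' , p') =
  cong₂ _,_ (transpose-maps b b') (trans (onlyInBlock-here b (Perm.transpose p p') p) (transpose-maps p p'))

-- A point equidistant from y and y' lies in the block of y iff in that of y', and equals y
-- iff it equals y'; so neither transposition moves it.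
moveTo-fixes : {z y y' : U l m} → classU z y ≡ classU z y' → apply (moveTo y y') z ≡ z
moveTo-fixes {z = z@(c , q)} {y@(b , p)} {y'@(b' , p')} e =
  cong₂ _,_ (transpose-fixes c≡b⇒b≡b' c≡b'⇒b≡b') (onlyInBlock-fixes {b = b} {c} points)
  where
  c≡b⇒b≡b' : c ≡ b → b ≡ b'
  c≡b⇒b≡b' c≡b = trans (sym c≡b) (sameBlock-transfer {z = z} {y} {y'} e c≡b)
  c≡b'⇒b≡b' : c ≡ b' → b ≡ b'
  c≡b'⇒b≡b' c≡b' = trans (sym (sameBlock-transfer {z = z} {y'} {y} (sym e) c≡b')) c≡b'
  points : c ≡ b → PC.transpose p p' q ≡ q
  points c≡b = transpose-fixes
    (λ q≡p → trans (sym q≡p) (cong proj₂ (equal-transfer {z = z} {y} {y'} e (cong₂ _,_ c≡b q≡p))))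
    (λ q≡p' → trans (sym (cong proj₂ (equal-transfer {z = z} {y'} {y} (sym e)
                                         (cong₂ _,_ (trans c≡b (c≡b⇒b≡b' c≡b)) q≡p')))) q≡p')

-- Move u to u' fixing x, then the image of w to w' fixing x and u'.
triangleType-homogeneous : {x u w u' w' : U l m} → triangleType x u w ≡ triangleType x u' w' →
                           Σ (Aut l m) λ α → apply α x ≡ x × apply α u ≡ u' × apply α w ≡ w'
triangleType-homogeneous {x = x} {u} {w} {u'} {w'} e =
  α₂ ∘ᴬ α₁ , trans (cong (apply α₂) α₁x) α₂x , trans (cong (apply α₂) α₁u) α₂u' , moveTo-maps v w'
  where
  α₁ = moveTo u u'
  v  = apply α₁ w
  α₂ = moveTo v w'
  α₁x : apply α₁ x ≡ x
  α₁x = moveTo-fixes (cong proj₁ e)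
  α₁u : apply α₁ u ≡ u'
  α₁u = moveTo-maps u u'
  α₂x : apply α₂ x ≡ x
  α₂x = moveTo-fixes (trans (cong (λ z → classU z v) (sym α₁x))
                            (trans (classU-apply α₁ x w) (cong (proj₂ ∘ proj₂) e)))
  α₂u' : apply α₂ u' ≡ u'
  α₂u' = moveTo-fixes (trans (cong (λ z → classU z v) (sym α₁u))
                             (trans (classU-apply α₁ u w) (cong (proj₁ ∘ proj₂) e)))

Realized : U l m → TriangleType → Set
Realized x t = ∃₂ λ u w → triangleType x u w ≡ t

origin : U (suc (suc l)) (suc (suc m))
origin = 0F , 0F

common-realized : All (Realized {suc (suc l)} {suc (suc m)} origin) commonTypes
common-realized =
  ((0F , 0F) , (0F , 0F) , refl) ∷ ((0F , 0F) , (0F , 1F) , refl) ∷ ((0F , 0F) , (1F , 0F) , refl) ∷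
  ((0F , 1F) , (0F , 1F) , refl) ∷ ((0F , 1F) , (0F , 0F) , refl) ∷ ((0F , 1F) , (1F , 0F) , refl) ∷
  ((1F , 0F) , (1F , 0F) , refl) ∷ ((1F , 0F) , (1F , 1F) , refl) ∷ ((1F , 0F) , (0F , 0F) , refl) ∷
  ((1F , 0F) , (0F , 1F) , refl) ∷ []

equilateral₁-realized : ∀ l m → All (Realized {suc (suc l)} {suc (suc m)} origin)
                                    (if 2 <ᵇ suc (suc m) then [ (1F , 1F , 1F) ] else [])
equilateral₁-realized l zero    = []
equilateral₁-realized l (suc m) = ((0F , 1F) , (0F , 2F) , refl) ∷ []

equilateral₂-realized : ∀ l m → All (Realized {suc (suc l)} {suc (suc m)} origin)
                                    (if 2 <ᵇ suc (suc l) then [ (2F , 2F , 2F) ] else [])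
equilateral₂-realized zero    m = []
equilateral₂-realized (suc l) m = ((1F , 0F) , (2F , 0F) , refl) ∷ []

realized-origin : ∀ l m → All (Realized origin) (triangleTypes (suc (suc l)) (suc (suc m)))
realized-origin l m =
  ++⁺ common-realized (++⁺ (equilateral₁-realized l m) (equilateral₂-realized l m))

-- Transport the witnesses at the origin along an automorphism moving the origin to x.
realized : 2 ≤ l → 2 ≤ m → (x : U l m) → All (Realized x) (triangleTypes l m)
realized {suc (suc l)} {suc (suc m)} (s≤s (s≤s z≤n)) (s≤s (s≤s z≤n)) x =
  All.map transport (realized-origin l m)
  where
  α = moveTo origin x
  transport : ∀ {t} → Realized origin t → Realized x t
  transport (u , w , e) = apply α u , apply α w ,
    trans (cong (λ z → triangleType z (apply α u) (apply α w)) (sym (moveTo-maps origin x)))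
          (trans (triangleType-apply α origin u w) e)

lookup-injective : ∀ {A : Set} {xs : List A} → Unique xs → ∀ {i j} → lookup xs i ≡ lookup xs j → i ≡ j
lookup-injective (_  ∷ _) {zero}  {zero}  _ = refl
lookup-injective (x∉ ∷ _) {zero}  {suc j} e = contradiction e (All.lookup x∉ (∈-lookup j))
lookup-injective (x∉ ∷ _) {suc i} {zero}  e = contradiction (sym e) (All.lookup x∉ (∈-lookup i))
lookup-injective (_  ∷ u) {suc i} {suc j} e = cong suc (lookup-injective u e)

typeCount : ℕ → ℕ → ℕ
typeCount l m = length (triangleTypes l m)

code : (x u w : U l m) → Fin (typeCount l m)
code x u w = index (triangleType∈ x u w)

code≡⇔ : {x u w : U l m} {c : Fin (typeCount l m)} →
         code x u w ≡ c ⇔ triangleType x u w ≡ lookup (triangleTypes l m) c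
code≡⇔ {l = l} {m} {x} {u} {w} = mk⇔
  (λ { refl → lookup-index (triangleType∈ x u w) })
  (λ e → lookup-injective (triangleTypes-unique l m) (trans (sym (lookup-index (triangleType∈ x u w))) e))

-- Mixed-radix codes and the dimension formula

module _ where
  open Nat using (_+_; _*_; _^_)
  open import Data.Nat.Properties using (^-distribˡ-+-*; +-identityʳ)
  open import Data.Nat.Solver using (module +-*-Solver)

  ∏ : ∀ {n} → (Fin n → ℕ) → ℕ
  ∏ {zero}  k = 1
  ∏ {suc n} k = k zero * ∏ (k ∘ suc)

  encodeΠ : ∀ {n} {k : Fin n → ℕ} → ((i : Fin n) → Fin (k i)) → Fin (∏ k)
  encodeΠ {zero}  c = zero
  encodeΠ {suc n} c = combine (c zero) (encodeΠ (c ∘ suc))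

  decodeΠ : ∀ {n} {k : Fin n → ℕ} → Fin (∏ k) → (i : Fin n) → Fin (k i)
  decodeΠ {suc n} {k} j zero    = proj₁ (remQuot {k zero} (∏ (k ∘ suc)) j)
  decodeΠ {suc n} {k} j (suc i) = decodeΠ (proj₂ (remQuot {k zero} (∏ (k ∘ suc)) j)) i

  decodeΠ-encodeΠ : ∀ {n} {k : Fin n → ℕ} (c : (i : Fin n) → Fin (k i)) i → decodeΠ (encodeΠ c) i ≡ c i
  decodeΠ-encodeΠ {suc n} {k} c zero    = cong proj₁ (remQuot-combine {k = ∏ (k ∘ suc)} (c zero) _)
  decodeΠ-encodeΠ {suc n} {k} c (suc i) =
    trans (cong (λ r → decodeΠ {k = k ∘ suc} (proj₂ r) i) (remQuot-combine {k = ∏ (k ∘ suc)} (c zero) _))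
          (decodeΠ-encodeΠ (c ∘ suc) i)

  encodeΠ-decodeΠ : ∀ {n} {k : Fin n → ℕ} (j : Fin (∏ k)) → encodeΠ {k = k} (decodeΠ j) ≡ j
  encodeΠ-decodeΠ {zero}  zero = refl
  encodeΠ-decodeΠ {suc n} {k} j =
    trans (cong (combine (decodeΠ {k = k} j zero)) (encodeΠ-decodeΠ {k = k ∘ suc} _))
          (combine-remQuot {k zero} (∏ (k ∘ suc)) j)

  encodeΠ-cong : ∀ {n} {k : Fin n → ℕ} {c c' : (i : Fin n) → Fin (k i)} →
                 (∀ i → c i ≡ c' i) → encodeΠ c ≡ encodeΠ c'
  encodeΠ-cong {zero}  _    = refl
  encodeΠ-cong {suc n} c≐c' = cong₂ combine (c≐c' zero) (encodeΠ-cong (c≐c' ∘ suc))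

  encodeΠ≡⇔ : ∀ {n} {k : Fin n → ℕ} {c : (i : Fin n) → Fin (k i)} {j} →
              encodeΠ c ≡ j ⇔ (∀ i → c i ≡ decodeΠ j i)
  encodeΠ≡⇔ {k = k} {c} = mk⇔
    (λ { refl i → sym (decodeΠ-encodeΠ c i) })
    (λ c≐j → trans (encodeΠ-cong c≐j) (encodeΠ-decodeΠ {k = k} _))

  formula : ℕ → ℕ → ℕ → ℕ → ℕ
  formula a b c d = 2 ^ (a + 2 * d) * 3 ^ d * 5 ^ a * 11 ^ (b + c)

  formula-+ : ∀ a b c d a' b' c' d' →
              formula (a + a') (b + b') (c + c') (d + d') ≡ formula a b c d * formula a' b' c' d'
  formula-+ a b c d a' b' c' d' = begin
    2 ^ ((a + a') + 2 * (d + d')) * 3 ^ (d + d') * 5 ^ (a + a') * 11 ^ ((b + b') + (c + c'))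
      ≡⟨ cong₂ (λ e f → 2 ^ e * 3 ^ (d + d') * 5 ^ (a + a') * 11 ^ f) exp₂ exp₁₁ ⟩
    2 ^ ((a + 2 * d) + (a' + 2 * d')) * 3 ^ (d + d') * 5 ^ (a + a') * 11 ^ ((b + c) + (b' + c'))
      ≡⟨ cong₂ (λ e f → e * 3 ^ (d + d') * 5 ^ (a + a') * f)
               (^-distribˡ-+-* 2 (a + 2 * d) (a' + 2 * d')) (^-distribˡ-+-* 11 (b + c) (b' + c')) ⟩
    2 ^ (a + 2 * d) * 2 ^ (a' + 2 * d') * 3 ^ (d + d') * 5 ^ (a + a') * (11 ^ (b + c) * 11 ^ (b' + c'))
      ≡⟨ cong₂ (λ e f → 2 ^ (a + 2 * d) * 2 ^ (a' + 2 * d') * e * f * (11 ^ (b + c) * 11 ^ (b' + c')))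
               (^-distribˡ-+-* 3 d d') (^-distribˡ-+-* 5 a a') ⟩
    2 ^ (a + 2 * d) * 2 ^ (a' + 2 * d') * (3 ^ d * 3 ^ d') * (5 ^ a * 5 ^ a') * (11 ^ (b + c) * 11 ^ (b' + c'))
      ≡⟨ regroup (2 ^ (a + 2 * d)) (2 ^ (a' + 2 * d')) (3 ^ d) (3 ^ d') (5 ^ a) (5 ^ a')
                 (11 ^ (b + c)) (11 ^ (b' + c')) ⟩
    formula a b c d * formula a' b' c' d' ∎
    where
    open ≡-Reasoning
    open +-*-Solver
    exp₂ : (a + a') + 2 * (d + d') ≡ (a + 2 * d) + (a' + 2 * d')
    exp₂ = solve 4 (λ a a' d d' → (a :+ a') :+ con 2 :* (d :+ d') := (a :+ con 2 :* d) :+ (a' :+ con 2 :* d'))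
                   refl a a' d d'
    exp₁₁ : (b + b') + (c + c') ≡ (b + c) + (b' + c')
    exp₁₁ = solve 4 (λ b b' c c' → (b :+ b') :+ (c :+ c') := (b :+ c) :+ (b' :+ c')) refl b b' c c'
    regroup : ∀ p p' q q' r r' s s' →
              p * p' * (q * q') * (r * r') * (s * s') ≡ (p * q * r * s) * (p' * q' * r' * s')
    regroup = solve 8 (λ p p' q q' r r' s s' →
      p :* p' :* (q :* q') :* (r :* r') :* (s :* s') := (p :* q :* r :* s) :* (p' :* q' :* r' :* s')) refl

  dimFormula-suc : ∀ n (ℓ m : Fin (suc n) → ℕ) →
                   dimFormula (suc n) ℓ m ≡
                   dimFormula 1 (λ _ → ℓ zero) (λ _ → m zero) * dimFormula n (ℓ ∘ suc) (m ∘ suc)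
  dimFormula-suc n ℓ m =
    trans (cong₂ (λ ad bc → formula (proj₁ ad) (proj₁ bc) (proj₂ bc) (proj₂ ad))
                 (cong₂ _,_ split₁ split₄) (cong₂ _,_ split₂ split₃))
          (formula-+ (n₁ 1 ℓ₀ m₀) (n₂ 1 ℓ₀ m₀) (n₃ 1 ℓ₀ m₀) (n₄ 1 ℓ₀ m₀)
                     (n₁ n ℓ' m') (n₂ n ℓ' m') (n₃ n ℓ' m') (n₄ n ℓ' m'))
    where
    ℓ₀ m₀ : Fin 1 → ℕ
    ℓ₀ _ = ℓ zero
    m₀ _ = m zero
    ℓ' m' : Fin n → ℕ
    ℓ' = ℓ ∘ suc
    m' = m ∘ suc
    split₁ : n₁ (suc n) ℓ m ≡ n₁ 1 ℓ₀ m₀ + n₁ n ℓ' m'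
    split₁ = cong (_+ n₁ n ℓ' m') (sym (+-identityʳ _))
    split₂ : n₂ (suc n) ℓ m ≡ n₂ 1 ℓ₀ m₀ + n₂ n ℓ' m'
    split₂ = cong (_+ n₂ n ℓ' m') (sym (+-identityʳ _))
    split₃ : n₃ (suc n) ℓ m ≡ n₃ 1 ℓ₀ m₀ + n₃ n ℓ' m'
    split₃ = cong (_+ n₃ n ℓ' m') (sym (+-identityʳ _))
    split₄ : n₄ (suc n) ℓ m ≡ n₄ 1 ℓ₀ m₀ + n₄ n ℓ' m'
    split₄ = cong (_+ n₄ n ℓ' m') (sym (+-identityʳ _))

  dimFormula-one : 2 ≤ l → 2 ≤ m → dimFormula 1 (λ _ → l) (λ _ → m) ≡ typeCount l m
  dimFormula-one {suc (suc zero)}    {suc (suc zero)}    (s≤s (s≤s _)) (s≤s (s≤s _)) = refl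
  dimFormula-one {suc (suc zero)}    {suc (suc (suc _))} (s≤s (s≤s _)) (s≤s (s≤s _)) = refl
  dimFormula-one {suc (suc (suc _))} {suc (suc zero)}    (s≤s (s≤s _)) (s≤s (s≤s _)) = refl
  dimFormula-one {suc (suc (suc _))} {suc (suc (suc _))} (s≤s (s≤s _)) (s≤s (s≤s _)) = refl

  dimFormula≡∏ : ∀ n (ℓ m : Fin n → ℕ) → (∀ i → 2 ≤ ℓ i) → (∀ i → 2 ≤ m i) →
                 dimFormula n ℓ m ≡ ∏ (λ i → typeCount (ℓ i) (m i))
  dimFormula≡∏ zero    ℓ m _  _  = refl
  dimFormula≡∏ (suc n) ℓ m hℓ hm = trans (dimFormula-suc n ℓ m)
    (cong₂ _*_ (dimFormula-one (hℓ zero) (hm zero))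
               (dimFormula≡∏ n (ℓ ∘ suc) (m ∘ suc) (hℓ ∘ suc) (hm ∘ suc)))

infix 4 _≐_
infixr 5 _·_

_≐_ : ∀ {n} {ℓ m : Fin n → ℕ} → Pt n ℓ m → Pt n ℓ m → Set
u ≐ v = ∀ i → u i ≡ v i

_·_ : ∀ {n} {ℓ m : Fin n → ℕ} → ((i : Fin n) → Aut (ℓ i) (m i)) → Pt n ℓ m → Pt n ℓ m
(α · z) i = apply (α i) (z i)

allB-cong : ∀ k {P Q : Fin k → Bool} → (∀ i → P i ≡ Q i) → allB k P ≡ allB k Q
allB-cong zero    _   = refl
allB-cong (suc k) P≗Q = cong₂ _∧_ (P≗Q zero) (allB-cong k (P≗Q ∘ suc))

T-allB : ∀ k {P : Fin k → Bool} → T (allB k P) ⇔ (∀ i → T (P i))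
T-allB zero    = mk⇔ (λ _ ()) _
T-allB (suc k) = mk⇔
  (λ h → let (h₀ , hs) = to T-∧ h in λ { zero → h₀ ; (suc i) → to (T-allB k) hs i })
  (λ h → from T-∧ (h zero , from (T-allB k) (h ∘ suc)))

T-does : ∀ {A : Set} (d : Dec A) → T (does d) ⇔ A
T-does (yes a) = mk⇔ (λ _ → a) _
T-does (no ¬a) = mk⇔ (λ ()) ¬a

module PointRelations {n : ℕ} {ℓ m : Fin n → ℕ} where

  inR-cong : ∀ g {a b a' b' : Pt n ℓ m} → (∀ i → classU (a i) (b i) ≡ classU (a' i) (b' i)) →
             inR n ℓ m g a b ≡ inR n ℓ m g a' b'
  inR-cong g same = allB-cong n (λ i → cong (_≡F3 g i) (same i))

  T-inR : ∀ g {a b : Pt n ℓ m} → T (inR n ℓ m g a b) ⇔ (∀ i → classU (a i) (b i) ≡ g i)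
  T-inR g = mk⇔ (λ h i → to (T-does (_ ≟ g i)) (to (T-allB n) h i))
                (λ h → from (T-allB n) (λ i → from (T-does (_ ≟ g i)) (h i)))

  T-triangle : (x u w : Pt n ℓ m) (g₁ g₂ g₃ : Idx n) →
               T (inR n ℓ m g₁ x u ∧ (inR n ℓ m g₂ u w ∧ inR n ℓ m g₃ x w)) ⇔
               (∀ i → triangleType (x i) (u i) (w i) ≡ (g₁ i , g₂ i , g₃ i))
  T-triangle x u w g₁ g₂ g₃ = mk⇔
    (λ h → let (h₁ , h₂₃) = to T-∧ h ; (h₂ , h₃) = to (T-∧ {inR n ℓ m g₂ u w}) h₂₃ in
      λ i → cong₂ _,_ (to (T-inR g₁ {x} {u}) h₁ i)
                      (cong₂ _,_ (to (T-inR g₂ {u} {w}) h₂ i) (to (T-inR g₃ {x} {w}) h₃ i)))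
    (λ same → from T-∧ (from (T-inR g₁ {x} {u}) (cong proj₁ ∘ same) ,
                        from T-∧ (from (T-inR g₂ {u} {w}) (cong (proj₁ ∘ proj₂) ∘ same) ,
                                  from (T-inR g₃ {x} {w}) (cong (proj₂ ∘ proj₂) ∘ same))))

  eqPt-sym : (a b : Pt n ℓ m) → eqPt n ℓ m a b ≡ eqPt n ℓ m b a
  eqPt-sym a b = inR-cong (λ _ → 0F) {a} {b} {b} {a} (λ i → classU-sym (a i) (b i))

  classU-· : (α : (i : Fin n) → Aut (ℓ i) (m i)) {a b a' b' : Pt n ℓ m} → α · a ≐ a' → α · b ≐ b' →
             ∀ i → classU (a i) (b i) ≡ classU (a' i) (b' i)
  classU-· α {a} {b} ha hb i = trans (sym (classU-apply (α i) (a i) (b i))) (cong₂ classU (ha i) (hb i))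

-- Sums over X

module Sums {c ℓF : Level} (F : Field c ℓF) where
  open Field F hiding (zero)
    renaming (refl to ≈-refl; sym to ≈-sym; trans to ≈-trans; reflexive to ≈-reflexive)
  open import Relation.Binary.Reasoning.Setoid setoid
  open PointRelations using (eqPt-sym)
  open import Algebra.Properties.Semiring.Sum semiring
    using (sum; sum-cong-≋; sum-permute; sum-replicate-zero; *-distribˡ-sum)

  𝟙 : Bool → Carrier
  𝟙 true  = 1#
  𝟙 false = 0#

  𝟙-∧ : ∀ a b → 𝟙 (a ∧ b) ≈ 𝟙 a * 𝟙 b
  𝟙-∧ true  b = ≈-sym (*-identityˡ (𝟙 b))
  𝟙-∧ false b = ≈-sym (zeroˡ (𝟙 b))

  Extensional : ∀ {n} {ℓ m : Fin n → ℕ} → (Pt n ℓ m → Carrier) → Set ℓF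
  Extensional f = ∀ {z z'} → z ≐ z' → f z ≈ f z'

  sumFin≡sum : ∀ k (f : Fin k → Carrier) → sumFin F k f ≡ sum f
  sumFin≡sum zero    f = refl
  sumFin≡sum (suc k) f = cong (f zero +_) (sumFin≡sum k (f ∘ suc))

  sumFin-cong : ∀ k {f g : Fin k → Carrier} → (∀ i → f i ≈ g i) → sumFin F k f ≈ sumFin F k g
  sumFin-cong k {f} {g} f≈g = begin
    sumFin F k f ≡⟨ sumFin≡sum k f ⟩
    sum f        ≈⟨ sum-cong-≋ f≈g ⟩
    sum g        ≡⟨ sumFin≡sum k g ⟨
    sumFin F k g ∎

  sumFin-distribˡ : ∀ k a (f : Fin k → Carrier) → a * sumFin F k f ≈ sumFin F k (λ i → a * f i)
  sumFin-distribˡ k a f = begin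
    a * sumFin F k f                ≡⟨ cong (a *_) (sumFin≡sum k f) ⟩
    a * sum f                       ≈⟨ *-distribˡ-sum a f ⟩
    sum (λ i → a * f i)             ≡⟨ sumFin≡sum k (λ i → a * f i) ⟨
    sumFin F k (λ i → a * f i)      ∎

  sumFin-permute : ∀ k (π : Permutation′ k) (f : Fin k → Carrier) → sumFin F k (λ i → f (π ⟨$⟩ʳ i)) ≈ sumFin F k f
  sumFin-permute k π f = begin
    sumFin F k (λ i → f (π ⟨$⟩ʳ i)) ≡⟨ sumFin≡sum k _ ⟩
    sum (λ i → f (π ⟨$⟩ʳ i))        ≈⟨ sum-permute f π ⟨
    sum f                           ≡⟨ sumFin≡sum k f ⟨
    sumFin F k f                    ∎

  sumFin-zero : ∀ k → sumFin F k (λ _ → 0#) ≈ 0#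
  sumFin-zero k = ≈-trans (≈-reflexive (sumFin≡sum k _)) (sum-replicate-zero k)

  sumFin-δ : ∀ k (j : Fin k) (f : Fin k → Carrier) → sumFin F k (λ i → 𝟙 (does (j ≟ i)) * f i) ≈ f j
  sumFin-δ (suc k) zero f = begin
    1# * f zero + sumFin F k (λ i → 0# * f (suc i)) ≈⟨ +-cong (*-identityˡ _) (sumFin-cong k (λ i → zeroˡ _)) ⟩
    f zero + sumFin F k (λ _ → 0#)                  ≈⟨ +-congˡ (sumFin-zero k) ⟩
    f zero + 0#                                     ≈⟨ +-identityʳ _ ⟩
    f zero                                          ∎
  sumFin-δ (suc k) (suc j) f = begin
    0# * f zero + sumFin F k (λ i → 𝟙 (does (j ≟ i)) * f (suc i)) ≈⟨ +-cong (zeroˡ _) (sumFin-δ k j (f ∘ suc)) ⟩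
    0# + f (suc j)                                                 ≈⟨ +-identityˡ _ ⟩
    f (suc j)                                                      ∎

  sumU-cong : ∀ l m {f g : U l m → Carrier} → (∀ a → f a ≈ g a) → sumU F l m f ≈ sumU F l m g
  sumU-cong l m f≈g = sumFin-cong l (λ b → sumFin-cong m (λ p → f≈g (b , p)))

  sumU-distribˡ : ∀ l m a (f : U l m → Carrier) → a * sumU F l m f ≈ sumU F l m (λ u → a * f u)
  sumU-distribˡ l m a f = ≈-trans (sumFin-distribˡ l a _)
    (sumFin-cong l (λ b → sumFin-distribˡ m a (λ p → f (b , p))))

  sumU-δ : ∀ l m (u : U l m) (f : U l m → Carrier) → sumU F l m (λ a → 𝟙 (classU u a ≡F3 0F) * f a) ≈ f u
  sumU-δ l m (b , p) f = begin
    sumFin F l (λ c → sumFin F m (λ q → 𝟙 (classU (b , p) (c , q) ≡F3 0F) * f (c , q)))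
      ≈⟨ sumFin-cong l (λ c → sumFin-cong m (λ q → split c q)) ⟩
    sumFin F l (λ c → sumFin F m (λ q → 𝟙 (does (b ≟ c)) * (𝟙 (does (p ≟ q)) * f (c , q))))
      ≈⟨ sumFin-cong l (λ c → sumFin-distribˡ m _ _) ⟨
    sumFin F l (λ c → 𝟙 (does (b ≟ c)) * sumFin F m (λ q → 𝟙 (does (p ≟ q)) * f (c , q)))
      ≈⟨ sumFin-cong l (λ c → *-congˡ (sumFin-δ m p (λ q → f (c , q)))) ⟩
    sumFin F l (λ c → 𝟙 (does (b ≟ c)) * f (c , p))
      ≈⟨ sumFin-δ l b (λ c → f (c , p)) ⟩
    f (b , p) ∎
    where
    split : ∀ c q → 𝟙 (classU (b , p) (c , q) ≡F3 0F) * f (c , q) ≈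
                    𝟙 (does (b ≟ c)) * (𝟙 (does (p ≟ q)) * f (c , q))
    split c q = ≈-trans (*-congʳ (≈-trans (≈-reflexive (cong 𝟙 (classU≡0-split b c p q)))
                                          (𝟙-∧ (does (b ≟ c)) _)))
                        (*-assoc _ _ _)

  sumU-apply : ∀ l m (α : Aut l m) (f : U l m → Carrier) → sumU F l m (λ a → f (apply α a)) ≈ sumU F l m f
  sumU-apply l m α f = begin
    sumFin F l (λ b → sumFin F m (λ p → f (onBlocks α ⟨$⟩ʳ b , inBlock α b ⟨$⟩ʳ p)))
      ≈⟨ sumFin-cong l (λ b → sumFin-permute m (inBlock α b) (λ p → f (onBlocks α ⟨$⟩ʳ b , p))) ⟩
    sumFin F l (λ b → sumFin F m (λ p → f (onBlocks α ⟨$⟩ʳ b , p)))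
      ≈⟨ sumFin-permute l (onBlocks α) (λ b → sumFin F m (λ p → f (b , p))) ⟩
    sumU F l m f ∎

  module _ {n : ℕ} {ℓ m : Fin (suc n) → ℕ} where
    private
      ℓ' m' : Fin n → ℕ
      ℓ' = ℓ ∘ suc
      m' = m ∘ suc

    consPt-cong : ∀ a {t t' : Pt n ℓ' m'} → t ≐ t' → consPt F {n} {ℓ} {m} a t ≐ consPt F a t'
    consPt-cong a t≐t' zero    = refl
    consPt-cong a t≐t' (suc i) = t≐t' i

    consPt-η : (z : Pt (suc n) ℓ m) → consPt F {n} {ℓ} {m} (z zero) (z ∘ suc) ≐ z
    consPt-η z zero    = refl
    consPt-η z (suc i) = refl

    consPt-· : (α : (i : Fin (suc n)) → Aut (ℓ i) (m i)) (a : U (ℓ zero) (m zero)) (t : Pt n ℓ' m') →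
               α · consPt F {n} {ℓ} {m} a t ≐ consPt F {n} {ℓ} {m} (apply (α zero) a) ((α ∘ suc) · t)
    consPt-· α a t zero    = refl
    consPt-· α a t (suc i) = refl

  sumX-cong : ∀ n ℓ m {f g : Pt n ℓ m → Carrier} → (∀ z → f z ≈ g z) → sumX F n ℓ m f ≈ sumX F n ℓ m g
  sumX-cong zero    ℓ m f≈g = f≈g _
  sumX-cong (suc n) ℓ m f≈g =
    sumU-cong (ℓ zero) (m zero) (λ a → sumX-cong n (ℓ ∘ suc) (m ∘ suc) (λ t → f≈g (consPt F a t)))

  sumX-distribˡ : ∀ n ℓ m a (f : Pt n ℓ m → Carrier) → a * sumX F n ℓ m f ≈ sumX F n ℓ m (λ z → a * f z)
  sumX-distribˡ zero    ℓ m a f = ≈-refl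
  sumX-distribˡ (suc n) ℓ m a f = ≈-trans (sumU-distribˡ (ℓ zero) (m zero) a _)
    (sumU-cong (ℓ zero) (m zero) (λ b → sumX-distribˡ n (ℓ ∘ suc) (m ∘ suc) a (λ t → f (consPt F b t))))

  sumX-δ : ∀ n ℓ m (u : Pt n ℓ m) {f : Pt n ℓ m → Carrier} → Extensional f →
           sumX F n ℓ m (λ z → 𝟙 (eqPt n ℓ m u z) * f z) ≈ f u
  sumX-δ zero    ℓ m u f-ext = ≈-trans (*-identityˡ _) (f-ext λ ())
  sumX-δ (suc n) ℓ m u {f} f-ext = begin
    sumU F l₀ m₀ (λ a → sumX F n ℓ' m' (λ t → 𝟙 (isU₀ a ∧ eqPt n ℓ' m' u' t) * f (consPt F a t)))
      ≈⟨ sumU-cong l₀ m₀ (λ a → sumX-cong n ℓ' m' (λ t →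
           ≈-trans (*-congʳ (𝟙-∧ (isU₀ a) _)) (*-assoc _ _ _))) ⟩
    sumU F l₀ m₀ (λ a → sumX F n ℓ' m' (λ t → 𝟙 (isU₀ a) * (𝟙 (eqPt n ℓ' m' u' t) * f (consPt F a t))))
      ≈⟨ sumU-cong l₀ m₀ (λ a → sumX-distribˡ n ℓ' m' _ _) ⟨
    sumU F l₀ m₀ (λ a → 𝟙 (isU₀ a) * sumX F n ℓ' m' (λ t → 𝟙 (eqPt n ℓ' m' u' t) * f (consPt F a t)))
      ≈⟨ sumU-cong l₀ m₀ (λ a → *-congˡ (sumX-δ n ℓ' m' u' (f-ext ∘ consPt-cong {ℓ = ℓ} {m} a))) ⟩
    sumU F l₀ m₀ (λ a → 𝟙 (isU₀ a) * f (consPt F a u'))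
      ≈⟨ sumU-δ l₀ m₀ (u zero) (λ a → f (consPt F a u')) ⟩
    f (consPt F (u zero) u')
      ≈⟨ f-ext (consPt-η {ℓ = ℓ} {m} u) ⟩
    f u ∎
    where
    l₀ = ℓ zero
    m₀ = m zero
    ℓ' = ℓ ∘ suc
    m' = m ∘ suc
    u' = u ∘ suc
    isU₀ : U l₀ m₀ → Bool
    isU₀ a = classU (u zero) a ≡F3 0F

  sumX-δʳ : ∀ n ℓ m (u : Pt n ℓ m) {f : Pt n ℓ m → Carrier} → Extensional f →
            sumX F n ℓ m (λ z → 𝟙 (eqPt n ℓ m z u) * f z) ≈ f u
  sumX-δʳ n ℓ m u f-ext = ≈-trans
    (sumX-cong n ℓ m (λ z → *-congʳ (≈-reflexive (cong 𝟙 (eqPt-sym z u))))) (sumX-δ n ℓ m u f-ext)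

  sumX-reindex : ∀ n ℓ m (α : (i : Fin n) → Aut (ℓ i) (m i)) {f : Pt n ℓ m → Carrier} → Extensional f →
                 sumX F n ℓ m (λ z → f (α · z)) ≈ sumX F n ℓ m f
  sumX-reindex zero    ℓ m α f-ext = f-ext λ ()
  sumX-reindex (suc n) ℓ m α {f} f-ext = begin
    sumU F l₀ m₀ (λ a → sumX F n ℓ' m' (λ t → f (α · consPt F a t)))
      ≈⟨ sumU-cong l₀ m₀ (λ a → sumX-cong n ℓ' m' (λ t → f-ext (consPt-· {ℓ = ℓ} {m} α a t))) ⟩
    sumU F l₀ m₀ (λ a → sumX F n ℓ' m' (λ t → f (consPt F (apply (α zero) a) ((α ∘ suc) · t))))
      ≈⟨ sumU-cong l₀ m₀ (λ a →
           sumX-reindex n ℓ' m' (α ∘ suc) (f-ext ∘ consPt-cong {ℓ = ℓ} {m} (apply (α zero) a))) ⟩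
    sumU F l₀ m₀ (λ a → g (apply (α zero) a))
      ≈⟨ sumU-apply l₀ m₀ (α zero) g ⟩
    sumU F l₀ m₀ g ∎
    where
    l₀ = ℓ zero
    m₀ = m zero
    ℓ' = ℓ ∘ suc
    m' = m ∘ suc
    g : U l₀ m₀ → Carrier
    g a = sumX F n ℓ' m' (λ t → f (consPt F a t))

-- The Terwilliger algebra

module Terwilliger {c ℓF : Level} (F : Field c ℓF) {n : ℕ} {ℓ m : Fin n → ℕ} where
  open Field F hiding (zero)
    renaming (refl to ≈-refl; sym to ≈-sym; trans to ≈-trans; reflexive to ≈-reflexive)
  open import Relation.Binary.Reasoning.Setoid setoid
  open import Algebra.Properties.CommutativeSemigroup *-commutativeSemigroup using (x∙yz≈y∙xz)
  open Sums F
  open Matrices F n ℓ m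
  open PointRelations

  ind≡𝟙 : ∀ b → ind b ≡ 𝟙 b
  ind≡𝟙 true  = refl
  ind≡𝟙 false = refl

  ind-∧ : ∀ a b → ind (a ∧ b) ≈ 𝟙 a * 𝟙 b
  ind-∧ a b = ≈-trans (≈-reflexive (ind≡𝟙 (a ∧ b))) (𝟙-∧ a b)

  Extensional₂ : Mat → Set ℓF
  Extensional₂ M = ∀ {u u' w w'} → u ≐ u' → w ≐ w' → M u w ≈ M u' w'

  hasDim-byFibres : ∀ {p} {S : Mat → Set p} {d} (κ : Pt n ℓ m → Pt n ℓ m → Fin d) →
                    (∀ j → ∃₂ λ u w → κ u w ≡ j) →
                    (∀ {M} → S M → ∀ {u w u' w'} → κ u w ≡ κ u' w' → M u w ≈ M u' w') →
                    (B : Fin d → Mat) → (∀ j → S (B j)) → (∀ j u w → B j u w ≈ 𝟙 (does (κ u w ≟ j))) →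
                    HasDim S d
  hasDim-byFibres {S = S} {d} κ rep S-const B B∈S B-δ = B , B∈S , independent , spanning
    where
    lincomb-δ : ∀ k u w → lincomb d k B u w ≈ k (κ u w)
    lincomb-δ k u w = begin
      sumFin F d (λ i → k i * B i u w)              ≈⟨ sumFin-cong d (λ i → ≈-trans (*-congˡ (B-δ i u w)) (*-comm _ _)) ⟩
      sumFin F d (λ i → 𝟙 (does (κ u w ≟ i)) * k i) ≈⟨ sumFin-δ d (κ u w) k ⟩
      k (κ u w)                                     ∎
    independent : ∀ k → lincomb d k B ≈M 0M → ∀ j → k j ≈ 0#
    independent k k·B≈0 j with rep j
    ... | u , w , refl = ≈-trans (≈-sym (lincomb-δ k u w)) (k·B≈0 u w)
    spanning : ∀ M → S M → Σ (Fin d → Carrier) λ k → M ≈M lincomb d k B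
    spanning M M∈S = (λ j → M (proj₁ (rep j)) (proj₁ (proj₂ (rep j)))) , λ u w →
      ≈-sym (≈-trans (lincomb-δ _ u w) (S-const M∈S (proj₂ (proj₂ (rep (κ u w))))))

  record Stabilizer (x : Pt n ℓ m) : Set where
    field
      aut   : (i : Fin n) → Aut (ℓ i) (m i)
      fixes : aut · x ≐ x

  open Stabilizer

  module _ (x : Pt n ℓ m) where

    -- Stated up to pointwise equality of points, as Pt is a function type; taking α = id
    -- therefore also gives extensionality.
    Invariant : Mat → Set ℓF
    Invariant M = ∀ (α : Stabilizer x) {u w u' w'} → aut α · u ≐ u' → aut α · w ≐ w' → M u w ≈ M u' w'

    invariant⇒extensional : ∀ {M} → Invariant M → Extensional₂ M
    invariant⇒extensional M-inv = M-inv (record { aut = λ _ → idAut ; fixes = λ _ → refl })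

    A-invariant : ∀ g → Invariant (A g)
    A-invariant g α {u} {w} {u'} {w'} hu hw =
      ≈-reflexive (cong ind (inR-cong g {u} {w} {u'} {w'} (classU-· (aut α) hu hw)))

    E*-invariant : ∀ g → Invariant (E* x g)
    E*-invariant g α {u} {w} {u'} {w'} hu hw = ≈-reflexive (cong ind (cong₂ _∧_
      (inR-cong (λ _ → 0F) {u} {w} {u'} {w'} (classU-· (aut α) hu hw))
      (inR-cong g {x} {u} {x} {u'} (classU-· (aut α) (fixes α) hu))))

    *M-invariant : ∀ {M N} → Invariant M → Invariant N → Invariant (M *M N)
    *M-invariant {M} {N} M-inv N-inv α {u} {w} {u'} {w'} hu hw = begin
      sumX F n ℓ m (λ z → M u z * N z w)
        ≈⟨ sumX-cong n ℓ m (λ z → *-cong (M-inv α hu (λ _ → refl)) (N-inv α (λ _ → refl) hw)) ⟩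
      sumX F n ℓ m (λ z → M u' (aut α · z) * N (aut α · z) w')
        ≈⟨ sumX-reindex n ℓ m (aut α) (λ z≐z' →
             *-cong (invariant⇒extensional M-inv (λ _ → refl) z≐z')
                    (invariant⇒extensional N-inv z≐z' (λ _ → refl))) ⟩
      sumX F n ℓ m (λ z → M u' z * N z w') ∎

    InT-invariant : ∀ {M} → InT x M → Invariant M
    InT-invariant (genA g)       = A-invariant g
    InT-invariant (genE g)       = E*-invariant g
    InT-invariant zeroT          = λ _ _ _ → ≈-refl
    InT-invariant (addT M∈ N∈)   = λ α hu hw → +-cong (InT-invariant M∈ α hu hw) (InT-invariant N∈ α hu hw)
    InT-invariant (scalT k M∈)   = λ α hu hw → *-congˡ (InT-invariant M∈ α hu hw)
    InT-invariant (mulT M∈ N∈)   = *M-invariant (InT-invariant M∈) (InT-invariant N∈)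
    InT-invariant (respT M≈N M∈) = λ α hu hw →
      ≈-trans (≈-sym (M≈N _ _)) (≈-trans (InT-invariant M∈ α hu hw) (M≈N _ _))

    SameTriangles : Pt n ℓ m → Pt n ℓ m → Pt n ℓ m → Pt n ℓ m → Set
    SameTriangles u w u' w' = ∀ i → triangleType (x i) (u i) (w i) ≡ triangleType (x i) (u' i) (w' i)

    invariant-sameTriangles : ∀ {M} → Invariant M → ∀ {u w u' w'} → SameTriangles u w u' w' → M u w ≈ M u' w'
    invariant-sameTriangles M-inv same = M-inv α (proj₁ ∘ proj₂ ∘ moved) (proj₂ ∘ proj₂ ∘ moved)
      where
      homogeneous = λ i → triangleType-homogeneous (same i)
      α : Stabilizer x
      α = record { aut = proj₁ ∘ homogeneous ; fixes = proj₁ ∘ proj₂ ∘ homogeneous }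
      moved = proj₂ ∘ homogeneous

    D : ℕ
    D = ∏ (λ i → typeCount (ℓ i) (m i))

    triangleCode : Pt n ℓ m → Pt n ℓ m → Fin D
    triangleCode u w = encodeΠ (λ i → code (x i) (u i) (w i))

    typeAt : Fin D → (i : Fin n) → TriangleType
    typeAt j i = lookup (triangleTypes (ℓ i) (m i)) (decodeΠ j i)

    triangleCode≡⇔ : ∀ {u w j} → triangleCode u w ≡ j ⇔ (∀ i → triangleType (x i) (u i) (w i) ≡ typeAt j i)
    triangleCode≡⇔ {u} {w} = mk⇔
      (λ e i → to (code≡⇔ {x = x i} {u i} {w i}) (to encodeΠ≡⇔ e i))
      (λ h → from encodeΠ≡⇔ (λ i → from (code≡⇔ {x = x i} {u i} {w i}) (h i)))

    triangleCode-injective : ∀ {u w u' w'} → triangleCode u w ≡ triangleCode u' w' → SameTriangles u w u' w'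
    triangleCode-injective e i = trans (to triangleCode≡⇔ e i) (sym (to triangleCode≡⇔ refl i))

    triangleCode-surjective : (∀ i → 2 ≤ ℓ i) → (∀ i → 2 ≤ m i) → ∀ j → ∃₂ λ u w → triangleCode u w ≡ j
    triangleCode-surjective hℓ hm j = proj₁ ∘ r , proj₁ ∘ proj₂ ∘ r , from triangleCode≡⇔ (proj₂ ∘ proj₂ ∘ r)
      where
      r : ∀ i → Realized (x i) (typeAt j i)
      r i = All.lookup (realized (hℓ i) (hm i) (x i)) (∈-lookup (decodeΠ j i))

    E*-*M-entry : ∀ g {M} → Extensional₂ M → ∀ u w → (E* x g *M M) u w ≈ 𝟙 (inR n ℓ m g x u) * M u w
    E*-*M-entry g {M} M-ext u w = begin
      sumX F n ℓ m (λ z → ind (eqPt n ℓ m u z ∧ xu) * M z w)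
        ≈⟨ sumX-cong n ℓ m (λ z → ≈-trans (*-congʳ (ind-∧ (eqPt n ℓ m u z) xu)) (*-assoc _ _ _)) ⟩
      sumX F n ℓ m (λ z → 𝟙 (eqPt n ℓ m u z) * (𝟙 xu * M z w))
        ≈⟨ sumX-δ n ℓ m u (λ z≐z' → *-congˡ (M-ext z≐z' (λ _ → refl))) ⟩
      𝟙 xu * M u w ∎
      where
      xu = inR n ℓ m g x u

    *M-E*-entry : ∀ g {M} → Extensional₂ M → ∀ u w → (M *M E* x g) u w ≈ M u w * 𝟙 (inR n ℓ m g x w)
    *M-E*-entry g {M} M-ext u w = begin
      sumX F n ℓ m (λ z → M u z * ind (eqPt n ℓ m z w ∧ xz z))
        ≈⟨ sumX-cong n ℓ m (λ z → ≈-trans (*-congˡ (ind-∧ (eqPt n ℓ m z w) (xz z))) (x∙yz≈y∙xz _ _ _)) ⟩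
      sumX F n ℓ m (λ z → 𝟙 (eqPt n ℓ m z w) * (M u z * 𝟙 (xz z)))
        ≈⟨ sumX-δʳ n ℓ m w (λ z≐z' → *-cong (M-ext (λ _ → refl) z≐z') (≈-reflexive (cong 𝟙 (xz-cong z≐z')))) ⟩
      M u w * 𝟙 (xz w) ∎
      where
      xz : Pt n ℓ m → Bool
      xz = inR n ℓ m g x
      xz-cong : ∀ {z z'} → z ≐ z' → xz z ≡ xz z'
      xz-cong {z} {z'} z≐z' = inR-cong g {x} {z} {x} {z'} (λ i → cong (classU (x i)) (z≐z' i))

    triangleBasis : Fin D → Mat
    triangleBasis j =
      E* x (proj₁ ∘ typeAt j) *M (A (proj₁ ∘ proj₂ ∘ typeAt j) *M E* x (proj₂ ∘ proj₂ ∘ typeAt j))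

    triangleBasis∈T : ∀ j → InT x (triangleBasis j)
    triangleBasis∈T j = mulT (genE _) (mulT (genA _) (genE _))

    triangleBasis-δ : ∀ j u w → triangleBasis j u w ≈ 𝟙 (does (triangleCode u w ≟ j))
    triangleBasis-δ j u w = begin
      triangleBasis j u w
        ≈⟨ E*-*M-entry g₁ (invariant⇒extensional (InT-invariant (mulT (genA g₂) (genE g₃)))) u w ⟩
      𝟙 p₁ * (A g₂ *M E* x g₃) u w
        ≈⟨ *-congˡ (*M-E*-entry g₃ (invariant⇒extensional (A-invariant g₂)) u w) ⟩
      𝟙 p₁ * (ind p₂ * 𝟙 p₃)
        ≡⟨ cong (λ e → 𝟙 p₁ * (e * 𝟙 p₃)) (ind≡𝟙 p₂) ⟩
      𝟙 p₁ * (𝟙 p₂ * 𝟙 p₃)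
        ≈⟨ ≈-trans (𝟙-∧ p₁ (p₂ ∧ p₃)) (*-congˡ (𝟙-∧ p₂ p₃)) ⟨
      𝟙 (p₁ ∧ (p₂ ∧ p₃))
        ≡⟨ cong 𝟙 (does-⇔ triangles⇔ (T? _) (triangleCode u w ≟ j)) ⟩
      𝟙 (does (triangleCode u w ≟ j)) ∎
      where
      g₁ g₂ g₃ : Idx n
      g₁ = proj₁ ∘ typeAt j
      g₂ = proj₁ ∘ proj₂ ∘ typeAt j
      g₃ = proj₂ ∘ proj₂ ∘ typeAt j
      p₁ p₂ p₃ : Bool
      p₁ = inR n ℓ m g₁ x u
      p₂ = inR n ℓ m g₂ u w
      p₃ = inR n ℓ m g₃ x w
      triangles⇔ : T (p₁ ∧ (p₂ ∧ p₃)) ⇔ triangleCode u w ≡ j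
      triangles⇔ = mk⇔ (from triangleCode≡⇔ ∘ to (T-triangle x u w g₁ g₂ g₃))
                       (from (T-triangle x u w g₁ g₂ g₃) ∘ to triangleCode≡⇔)

    hasDim : (∀ i → 2 ≤ ℓ i) → (∀ i → 2 ≤ m i) → HasDim (InT x) D
    hasDim hℓ hm = hasDim-byFibres triangleCode (triangleCode-surjective hℓ hm)
      (λ M∈T sameCode → invariant-sameTriangles (InT-invariant M∈T) (triangleCode-injective sameCode))
      triangleBasis triangleBasis∈T triangleBasis-δ

lemma3p6 : ∀ {c ℓF : Level} (F : Field c ℓF) (n : ℕ) (ℓ m : Fin n → ℕ) →
           (∀ i → 2 ≤ ℓ i) → (∀ i → 2 ≤ m i) →
           (x : Pt n ℓ m) →
           Matrices.HasDim F n ℓ m (Matrices.InT F n ℓ m x) (dimFormula n ℓ m)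
lemma3p6 F n ℓ m hℓ hm x =
  subst (Matrices.HasDim F n ℓ m (Matrices.InT F n ℓ m x)) (sym (dimFormula≡∏ n ℓ m hℓ hm))
        (Terwilliger.hasDim F x hℓ hm)
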